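{- Let $d$ and $g$ be integers greater than $2$. If there is a constant $B$ such that every finite $d$-regular graph with girth $g$ has independence ratio at least $B$, then every finite graph with maximum degree $d$ and girth $g$ also has independence ratio at least $B$.
   Context: The independence ratio of a graph $G$ is $\alpha(G)/|V(G)|$, where $\alpha(G)$ is its independence number. The girth of a graph is the length of a shortest cycle.
   Formalization: The constant B is taken to be rational. -}

module Defs where

open import Data.Nat using (ℕ; zero; suc; _≤_; _<_)
open import Data.Bool using (Bool; true; false)
open import Data.Fin using (Fin; zero; suc; inject₁; fromℕ)
open import Data.Fin.Subset using (Subset; _∈_; ∣_∣)
open import Data.Vec using (tabulate)
open import Data.Product using (Σ; ∃; _×_)
open import Data.Integer using (+_)
open import Data.Rational using (ℚ; _/_; 0ℚ)
import Data.Rational as Q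
open import Function.Definitions using (Injective)
open import Relation.Binary.PropositionalEquality using (_≡_)
open import Relation.Nullary using (¬_)

record Graph : Set where
  field
    n      : ℕ
    adj    : Fin n → Fin n → Bool
    sym    : ∀ i j → adj i j ≡ adj j i
    irrefl : ∀ i → adj i i ≡ false

open Graph public

Adj : (G : Graph) → Fin (n G) → Fin (n G) → Set
Adj G i j = adj G i j ≡ true

degree : (G : Graph) → Fin (n G) → ℕ
degree G v = ∣ tabulate (adj G v) ∣

Regular : Graph → ℕ → Set
Regular G d = ∀ v → degree G v ≡ d

MaxDegree : Graph → ℕ → Set
MaxDegree G d = (∀ v → degree G v ≤ d) × ∃ λ v → degree G v ≡ d

-- G contains a cycle of length suc m: distinct vertices
-- f 0, ..., f m with f i ~ f (i+1) and f m ~ f 0.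
CycleOfLength' : (G : Graph) → ℕ → Set
CycleOfLength' G m =
  Σ (Fin (suc m) → Fin (n G)) λ f →
    Injective _≡_ _≡_ f
    × (∀ (i : Fin m) → Adj G (f (inject₁ i)) (f (suc i)))
    × Adj G (f (fromℕ m)) (f zero)

HasCycleOfLength : Graph → ℕ → Set
HasCycleOfLength G zero    = Data.Empty.⊥ where import Data.Empty
HasCycleOfLength G (suc m) = (3 ≤ suc m) × CycleOfLength' G m

Girth : Graph → ℕ → Set
Girth G g = HasCycleOfLength G g × (∀ k → k < g → ¬ HasCycleOfLength G k)

Independent : (G : Graph) → Subset (n G) → Set
Independent G S = ∀ i j → i ∈ S → j ∈ S → ¬ Adj G i j

IsIndependenceNumber : Graph → ℕ → Set
IsIndependenceNumber G a =
  (∃ λ S → Independent G S × ∣ S ∣ ≡ a)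
  × (∀ S → Independent G S → ∣ S ∣ ≤ a)

-- a / |V(G)| as a rational (convention: 0 for the empty graph)
ratio : ℕ → ℕ → ℚ
ratio a zero    = 0ℚ
ratio a (suc m) = (+ a) / suc m

IndependenceRatioAtLeast : Graph → ℚ → Set
IndependenceRatioAtLeast G B =
  ∀ a → IsIndependenceNumber G a → B Q.≤ ratio a (n G)

module Submission where

-- Given G with maximum degree d and girth g we build a
-- d-regular graph H of girth g whose independence ratio is at most that
-- of G; the hypothesis on regular graphs applied to H then bounds G.
--
-- H is a "lift" of G: its vertices are pairs (u , π) with u a vertex of
-- G and π a permutation of a finite set W.  Each layer V(G) × {π} is a
-- copy of G, and a vertex u of degree deg u is joined, inside its fibre,
-- to the d ∸ deg u vertices (u , π ∘ σ_c) with c ∈ {u} × [0 , d ∸ deg u).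
-- Here W is the set of words of length g + 2 over the colours
-- V(G) × Fin d and σ_c is the involution "prepend c / cancel a leading
-- c".  Then
--   * H is d-regular (each vertex has deg u layer- and d ∸ deg u
--     fibre-neighbours);
--   * each layer is a copy of G, so α(H) ≤ #layers · α(G) while
--     |V(H)| = #layers · |V(G)|;
--   * a g-cycle of G lifts to a layer, and a shorter cycle of H would
--     either stay in one layer (a short cycle of G) or, read through its
--     fibre steps, turn the empty word into a nonempty word that must
--     nevertheless be empty again when the cycle closes.
-- The file first develops finite counting over Fin, enumeration of
-- decidable subsets, and existence of the independence number; then the
-- word action, the permutation layers, and the lift with its three
-- properties; the corollary comes last.

open import Defs
open import Data.Nat using (ℕ; _<_)
open import Data.Rational using (ℚ)

open import Data.Nat using (zero; suc; _+_; _*_; _∸_; _≤_; z≤n; s≤s; _^_; _<ᵇ_)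
import Data.Nat.Properties as NP
open import Data.Bool using (Bool; true; false; _∧_; _∨_; if_then_else_)
import Data.Bool.Properties as BP
open import Data.Fin using (Fin; zero; suc; toℕ; combine; remQuot; inject₁; fromℕ; fromℕ<; _↑ˡ_; _↑ʳ_; finToFun; funToFin)
import Data.Fin.Properties as FP
open import Data.Fin.Subset as SS using (Subset; inside; outside)
open import Data.Fin.Subset.Properties using (_∈?_)
open import Data.Vec using ([]; _∷_; tabulate; lookup)
import Data.Vec.Properties as VP
open import Data.Product using (Σ; _×_; _,_; proj₁; proj₂)
open import Data.Sum using (_⊎_; inj₁; inj₂)
open import Data.Empty using (⊥; ⊥-elim)
open import Relation.Nullary using (¬_; Dec; yes; no; does)
open import Relation.Nullary.Decidable using (_→-dec_; ¬?; dec-true)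
open import Relation.Binary.PropositionalEquality renaming (sym to esym)
open import Function using (_∘_; id)
open import Function.Definitions using (Injective)
open import Algebra.Properties.CommutativeSemigroup NP.+-commutativeSemigroup using (interchange)
import Data.Rational as Q
import Data.Rational.Properties as QP
import Data.Rational.Unnormalised as U
import Data.Rational.Unnormalised.Properties as UP
import Data.Integer as Z
import Data.Integer.Properties as ZP

-- Comparing two ratios a / k and b / k' by cross-multiplication; the
-- vertices witness that both denominators are nonzero.
ratio-≤ : ∀ {a b k k'} → Fin k → Fin k' → a * k' ≤ b * k → ratio a k Q.≤ ratio b k'
ratio-≤ {a} {b} {suc s} {suc t} _ _ h =
  QP.toℚᵘ-cancel-≤
    (UP.≤-respʳ-≃ (UP.≃-sym (QP.toℚᵘ-fromℚᵘ (U.mkℚᵘ (Z.+ b) t)))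
      (UP.≤-respˡ-≃ (UP.≃-sym (QP.toℚᵘ-fromℚᵘ (U.mkℚᵘ (Z.+ a) s)))
        (U.*≤* (subst₂ Z._≤_ (ZP.pos-* a (suc t)) (ZP.pos-* b (suc s)) (Z.+≤+ h)))))

decided : ∀ {A : Set} (a? : Dec A) → does a? ≡ true → A
decided (yes a) _ = a

false≢true : false ≢ true
false≢true ()

n≢2+n : (k : ℕ) → k ≢ suc (suc k)
n≢2+n zero    ()
n≢2+n (suc k) e = n≢2+n k (NP.suc-injective e)

-- Boolean equality on Fin, defined by recursion so that it computes on
-- constructors (used for indicator sums below).
eqF : ∀ {k} → Fin k → Fin k → Bool
eqF zero    zero    = true
eqF zero    (suc y) = false
eqF (suc x) zero    = false
eqF (suc x) (suc y) = eqF x y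

eqF-refl : ∀ {k} (x : Fin k) → eqF x x ≡ true
eqF-refl zero    = refl
eqF-refl (suc x) = eqF-refl x

eqF-sound : ∀ {k} (x y : Fin k) → eqF x y ≡ true → x ≡ y
eqF-sound zero    zero    e = refl
eqF-sound (suc x) (suc y) e = cong suc (eqF-sound x y e)

eqF-false : ∀ {k} (x y : Fin k) → x ≢ y → eqF x y ≡ false
eqF-false x y x≢y with eqF x y in e
... | true  = ⊥-elim (x≢y (eqF-sound x y e))
... | false = refl

eqF-sym : ∀ {k} (x y : Fin k) → eqF x y ≡ eqF y x
eqF-sym zero    zero    = refl
eqF-sym zero    (suc y) = refl
eqF-sym (suc x) zero    = refl
eqF-sym (suc x) (suc y) = eqF-sym x y

eqF-iff : ∀ {k} {x y x' y' : Fin k} → (x ≡ y → x' ≡ y') → (x' ≡ y' → x ≡ y) → eqF x y ≡ eqF x' y'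
eqF-iff {x = x} {y} {x'} {y'} to from with eqF x y in e | eqF x' y' in e'
... | true  | true  = refl
... | false | false = refl
... | true  | false = trans (esym (eqF-refl x')) (trans (cong (eqF x') (to (eqF-sound _ _ e))) e')
... | false | true  = esym (trans (esym (eqF-refl x)) (trans (cong (eqF x) (from (eqF-sound _ _ e'))) e))

∧-true : ∀ {a b} → (a ∧ b) ≡ true → a ≡ true × b ≡ true
∧-true {true} {true} _ = refl , refl

∨-true : ∀ {a b} → (a ∨ b) ≡ true → a ≡ true ⊎ b ≡ true
∨-true {true}  _ = inj₁ refl
∨-true {false} e = inj₂ e

bit : Bool → ℕ
bit true  = 1
bit false = 0

sumFin : ∀ {k} → (Fin k → ℕ) → ℕ
sumFin {zero}  f = 0
sumFin {suc k} f = f zero + sumFin (f ∘ suc)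

count : ∀ {k} → (Fin k → Bool) → ℕ
count p = sumFin (bit ∘ p)

sumFin-cong : ∀ {k} {f h : Fin k → ℕ} → (∀ x → f x ≡ h x) → sumFin f ≡ sumFin h
sumFin-cong {zero}  e = refl
sumFin-cong {suc k} e = cong₂ _+_ (e zero) (sumFin-cong (e ∘ suc))

sumFin-zero : ∀ {k} (f : Fin k → ℕ) → (∀ x → f x ≡ 0) → sumFin f ≡ 0
sumFin-zero {zero}  f e = refl
sumFin-zero {suc k} f e rewrite e zero = sumFin-zero (f ∘ suc) (e ∘ suc)

sumFin-+ : ∀ {k} (f h : Fin k → ℕ) → sumFin (λ x → f x + h x) ≡ sumFin f + sumFin h
sumFin-+ {zero}  f h = refl
sumFin-+ {suc k} f h rewrite sumFin-+ (f ∘ suc) (h ∘ suc) =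
  interchange (f zero) (h zero) (sumFin (f ∘ suc)) (sumFin (h ∘ suc))

sumFin-≤ : ∀ {k} (f : Fin k → ℕ) (a : ℕ) → (∀ x → f x ≤ a) → sumFin f ≤ k * a
sumFin-≤ {zero}  f a h = z≤n
sumFin-≤ {suc k} f a h = NP.+-mono-≤ (h zero) (sumFin-≤ (f ∘ suc) a (h ∘ suc))

sumFin-swap : ∀ {a b} (f : Fin a → Fin b → ℕ) →
  sumFin (λ i → sumFin (f i)) ≡ sumFin (λ j → sumFin (λ i → f i j))
sumFin-swap {zero}  {b} f = esym (sumFin-zero {b} _ (λ _ → refl))
sumFin-swap {suc a} {b} f = begin
  sumFin (f zero) + sumFin (λ i → sumFin (f (suc i)))
    ≡⟨ cong (sumFin (f zero) +_) (sumFin-swap (f ∘ suc)) ⟩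
  sumFin (f zero) + sumFin (λ j → sumFin (λ i → f (suc i) j))
    ≡⟨ esym (sumFin-+ (f zero) (λ j → sumFin (λ i → f (suc i) j))) ⟩
  sumFin (λ j → sumFin (λ i → f i j)) ∎
  where open ≡-Reasoning

sumFin-↑ : ∀ {m k} (h : Fin (m + k) → ℕ) →
  sumFin h ≡ sumFin {m} (λ i → h (i ↑ˡ k)) + sumFin {k} (λ i → h (m ↑ʳ i))
sumFin-↑ {zero}      h = refl
sumFin-↑ {suc m} {k} h rewrite sumFin-↑ {m} {k} (h ∘ suc) = esym (NP.+-assoc (h zero) _ _)

sumFin-combine : ∀ {a b} (h : Fin (a * b) → ℕ) →
  sumFin h ≡ sumFin {a} (λ i → sumFin {b} (λ j → h (combine i j)))
sumFin-combine {zero}      h = refl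
sumFin-combine {suc a} {b} h rewrite sumFin-↑ {b} {a * b} h =
  cong (sumFin {b} (λ i → h (i ↑ˡ a * b)) +_) (sumFin-combine {a} {b} (λ x → h (b ↑ʳ x)))

sumFin-point : ∀ {k} (x : Fin k) (h : Fin k → ℕ) → sumFin (λ y → if eqF x y then h y else 0) ≡ h x
sumFin-point {suc k} zero h = trans (cong (h zero +_) (sumFin-zero {k} _ (λ _ → refl))) (NP.+-identityʳ (h zero))
sumFin-point {suc k} (suc x) h = sumFin-point x (h ∘ suc)

count-point : ∀ {k} (x : Fin k) (A : Bool) → sumFin (λ y → bit (eqF x y ∧ A)) ≡ bit A
count-point x A = trans (sumFin-cong indicator) (sumFin-point x (λ _ → bit A))
  where
  indicator : ∀ y → bit (eqF x y ∧ A) ≡ (if eqF x y then bit A else 0)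
  indicator y with eqF x y
  ... | true  = refl
  ... | false = refl

count-below : ∀ d r → r ≤ d → count {d} (λ j → toℕ j <ᵇ r) ≡ r
count-below zero    zero    z≤n     = refl
count-below (suc d) zero    z≤n     = sumFin-zero {d} _ (λ _ → refl)
count-below (suc d) (suc r) (s≤s h) = cong suc (count-below d r h)

bit-∨ : ∀ a b → (a ≡ true → b ≡ true → ⊥) → bit (a ∨ b) ≡ bit a + bit b
bit-∨ true  true  h = ⊥-elim (h refl refl)
bit-∨ true  false h = refl
bit-∨ false b     h = refl

anyF : ∀ {k} → (Fin k → Bool) → Bool
anyF {zero}  p = false
anyF {suc k} p = p zero ∨ anyF (p ∘ suc)

anyF-sound : ∀ {k} (p : Fin k → Bool) → anyF p ≡ true → Σ (Fin k) λ x → p x ≡ true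
anyF-sound {suc k} p e with p zero in e0
... | true  = zero , e0
... | false = let (x , px) = anyF-sound (p ∘ suc) e in suc x , px

anyF-cong : ∀ {k} {p p' : Fin k → Bool} → (∀ x → p x ≡ p' x) → anyF p ≡ anyF p'
anyF-cong {zero}  e = refl
anyF-cong {suc k} e = cong₂ _∨_ (e zero) (anyF-cong (e ∘ suc))

anyF-false : ∀ {k} (p : Fin k → Bool) → (∀ x → p x ≡ false) → anyF p ≡ false
anyF-false {zero}  p e = refl
anyF-false {suc k} p e rewrite e zero = anyF-false (p ∘ suc) (e ∘ suc)

anyF-unique : ∀ {k} (p : Fin k → Bool) → (∀ x y → p x ≡ true → p y ≡ true → x ≡ y) →
  bit (anyF p) ≡ count p
anyF-unique {zero}  p u = refl
anyF-unique {suc k} p u with p zero in e0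
... | true  = cong suc (esym (sumFin-zero _ rest-false))
  where
  rest-false : ∀ x → bit (p (suc x)) ≡ 0
  rest-false x with p (suc x) in e1
  ... | true  with () ← u zero (suc x) e0 e1
  ... | false = refl
... | false = anyF-unique (p ∘ suc) (λ x y px py → FP.suc-injective (u (suc x) (suc y) px py))

size-tabulate : ∀ {k} (p : Fin k → Bool) → SS.∣ tabulate p ∣ ≡ count p
size-tabulate {zero}  p = refl
size-tabulate {suc k} p with p zero
... | true  = cong suc (size-tabulate (p ∘ suc))
... | false = size-tabulate (p ∘ suc)

size-lookup : ∀ {k} (S : Subset k) → SS.∣ S ∣ ≡ count (lookup S)
size-lookup S = trans (cong SS.∣_∣ (esym (VP.tabulate∘lookup S))) (size-tabulate (lookup S))

-- Enumeration of {x | p x} by Fin (count p): an injective map onto the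
-- elements satisfying p.  It turns a decidable subset of Fin k into a
-- vertex type of the form Fin n.
enum : ∀ {k} (p : Fin k → Bool) → Fin (count p) → Fin k
enumFrom : ∀ {k} (p : Fin (suc k) → Bool) (b : Bool) → Fin (bit b + count (p ∘ suc)) → Fin (suc k)
enum {suc k} p q = enumFrom p (p zero) q
enumFrom p true  zero    = zero
enumFrom p true  (suc q) = suc (enum (p ∘ suc) q)
enumFrom p false q       = suc (enum (p ∘ suc) q)

enum-sat : ∀ {k} (p : Fin k → Bool) (q : Fin (count p)) → p (enum p q) ≡ true
enumFrom-sat : ∀ {k} (p : Fin (suc k) → Bool) (b : Bool) → p zero ≡ b →
  (q : Fin (bit b + count (p ∘ suc))) → p (enumFrom p b q) ≡ true
enum-sat {suc k} p q = enumFrom-sat p (p zero) refl q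
enumFrom-sat p true  e zero    = e
enumFrom-sat p true  e (suc q) = enum-sat (p ∘ suc) q
enumFrom-sat p false e q       = enum-sat (p ∘ suc) q

enum-injective : ∀ {k} (p : Fin k → Bool) (q q' : Fin (count p)) → enum p q ≡ enum p q' → q ≡ q'
enumFrom-injective : ∀ {k} (p : Fin (suc k) → Bool) (b : Bool) (q q' : Fin (bit b + count (p ∘ suc))) →
  enumFrom p b q ≡ enumFrom p b q' → q ≡ q'
enum-injective {suc k} p q q' e = enumFrom-injective p (p zero) q q' e
enumFrom-injective p true  zero    zero     e = refl
enumFrom-injective p true  (suc q) (suc q') e = cong suc (enum-injective (p ∘ suc) q q' (FP.suc-injective e))
enumFrom-injective p false q       q'       e = enum-injective (p ∘ suc) q q' (FP.suc-injective e)

enum-surjective : ∀ {k} (p : Fin k → Bool) (r : Fin k) → p r ≡ true → Σ (Fin (count p)) λ q → enum p q ≡ r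
enumFrom-surjective : ∀ {k} (p : Fin (suc k) → Bool) (b : Bool) → p zero ≡ b → (r : Fin (suc k)) → p r ≡ true →
  Σ (Fin (bit b + count (p ∘ suc))) λ q → enumFrom p b q ≡ r
enum-surjective {suc k} p r e = enumFrom-surjective p (p zero) refl r e
enumFrom-surjective p true  _  zero    _ = zero , refl
enumFrom-surjective p true  _  (suc r) e = let (q , eq) = enum-surjective (p ∘ suc) r e in suc q , cong suc eq
enumFrom-surjective p false e0 zero    e = ⊥-elim (false≢true (trans (esym e0) e))
enumFrom-surjective p false _  (suc r) e = let (q , eq) = enum-surjective (p ∘ suc) r e in q , cong suc eq

maximumSubset : ∀ k (P : Subset k → Set) → (∀ S → Dec (P S)) →
  (∀ S → ¬ P S) ⊎ Σ (Subset k) (λ S → P S × (∀ T → P T → SS.∣ T ∣ ≤ SS.∣ S ∣))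
maximumSubset zero P P? with P? []
... | yes p = inj₂ ([] , p , λ { [] _ → z≤n })
... | no ¬p = inj₁ λ { [] → ¬p }
maximumSubset (suc k) P P?
  with maximumSubset k (λ S → P (inside ∷ S)) (λ S → P? (inside ∷ S))
     | maximumSubset k (λ S → P (outside ∷ S)) (λ S → P? (outside ∷ S))
... | inj₁ n₁ | inj₁ n₂ = inj₁ λ { (true ∷ S) → n₁ S ; (false ∷ S) → n₂ S }
... | inj₂ (S₁ , p₁ , m₁) | inj₁ n₂ =
  inj₂ (inside ∷ S₁ , p₁ , λ { (true ∷ T) pT → s≤s (m₁ T pT) ; (false ∷ T) pT → ⊥-elim (n₂ T pT) })
... | inj₁ n₁ | inj₂ (S₂ , p₂ , m₂) =
  inj₂ (outside ∷ S₂ , p₂ , λ { (true ∷ T) pT → ⊥-elim (n₁ T pT) ; (false ∷ T) pT → m₂ T pT })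
... | inj₂ (S₁ , p₁ , m₁) | inj₂ (S₂ , p₂ , m₂) with NP.≤-total (SS.∣ S₂ ∣) (suc SS.∣ S₁ ∣)
...   | inj₁ le = inj₂ (inside ∷ S₁ , p₁ ,
          λ { (true ∷ T) pT → s≤s (m₁ T pT) ; (false ∷ T) pT → NP.≤-trans (m₂ T pT) le })
...   | inj₂ ge = inj₂ (outside ∷ S₂ , p₂ ,
          λ { (true ∷ T) pT → NP.≤-trans (s≤s (m₁ T pT)) ge ; (false ∷ T) pT → m₂ T pT })

independent? : ∀ G S → Dec (Independent G S)
independent? G S = FP.all? λ i → FP.all? λ j →
  (i ∈? S) →-dec (j ∈? S) →-dec ¬? (adj G i j BP.≟ true)

emptyIndependent : ∀ G → Independent G SS.⊥
emptyIndependent G i j i∈ _ _ = false≢true (trans (esym (VP.lookup-replicate i outside)) (VP.[]=⇒lookup i∈))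

independenceNumber : ∀ G → Σ ℕ (IsIndependenceNumber G)
independenceNumber G with maximumSubset (n G) (Independent G) (independent? G)
... | inj₁ none = ⊥-elim (none SS.⊥ (emptyIndependent G))
... | inj₂ (S , indS , maxS) = SS.∣ S ∣ , (S , indS , refl) , maxS

funToFin-cong : ∀ {m k} {f h : Fin m → Fin k} → (∀ x → f x ≡ h x) → funToFin f ≡ funToFin h
funToFin-cong {zero}  e = refl
funToFin-cong {suc m} e = cong₂ combine (e zero) (funToFin-cong (e ∘ suc))

-- Words of length L + 2 over the colours Fin K, padded with blanks
-- (letter zero; colour c is the letter suc c), and for each colour c the
-- involution σ c: delete a leading c, or prepend c if the word has room;
-- words starting with c c, and full words not starting with c, are fixed.
-- Only two facts are used later: σ c is an involution, and it prepends c
-- to a word with room that does not already start with c.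
-- Words are coded by Fin codeCount so that they can index vertices.
module Words (K L : ℕ) where
  Letter : Set
  Letter = Fin (suc K)

  len : ℕ
  len = suc (suc L)

  Word : Set
  Word = Fin len → Letter

  lastPos : Fin len
  lastPos = fromℕ (suc L)

  push : Fin K → Word → Word
  push c w zero    = suc c
  push c w (suc i) = w (inject₁ i)

  shiftL : ∀ {k} → (Fin k → Letter) → Fin (suc k) → Letter
  shiftL {zero}  f zero    = zero
  shiftL {suc k} f zero    = f zero
  shiftL {suc k} f (suc i) = shiftL (f ∘ suc) i

  pop : Word → Word
  pop w = shiftL (w ∘ suc)

  shiftL-inject : ∀ {k} (f : Fin k → Letter) i → shiftL f (inject₁ i) ≡ f i
  shiftL-inject {suc k} f zero    = refl
  shiftL-inject {suc k} f (suc i) = shiftL-inject (f ∘ suc) i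

  shiftL-last : ∀ {k} (f : Fin k → Letter) → shiftL f (fromℕ k) ≡ zero
  shiftL-last {zero}  f = refl
  shiftL-last {suc k} f = shiftL-last (f ∘ suc)

  shiftL-cong : ∀ {k} {f h : Fin k → Letter} → (∀ x → f x ≡ h x) → ∀ i → shiftL f i ≡ shiftL h i
  shiftL-cong {zero}  e zero    = refl
  shiftL-cong {suc k} e zero    = e zero
  shiftL-cong {suc k} e (suc i) = shiftL-cong (e ∘ suc) i

  shiftL-inject₁ : ∀ {k} (w : Fin (suc k) → Letter) → w (fromℕ k) ≡ zero → ∀ i → shiftL (w ∘ inject₁) i ≡ w i
  shiftL-inject₁ {zero}  w e zero    = esym e
  shiftL-inject₁ {suc k} w e zero    = refl
  shiftL-inject₁ {suc k} w e (suc i) = shiftL-inject₁ (w ∘ suc) e i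

  pop-push : ∀ c w → w lastPos ≡ zero → ∀ i → pop (push c w) i ≡ w i
  pop-push c w = shiftL-inject₁ w

  push-pop : ∀ c w → w zero ≡ suc c → ∀ i → push c (pop w) i ≡ w i
  push-pop c w e zero    = esym e
  push-pop c w e (suc i) = shiftL-inject (w ∘ suc) i

  flipBy : Bool → Bool → Bool → Fin K → Word → Word
  flipBy true  true  _     c w = w
  flipBy true  false _     c w = pop w
  flipBy false _     true  c w = push c w
  flipBy false _     false c w = w

  flip : Fin K → Word → Word
  flip c w = flipBy (eqF (w zero) (suc c)) (eqF (w (suc zero)) (suc c)) (eqF (w lastPos) zero) c w

  flip-cases : ∀ c w {b₁ b₂ b₃} → eqF (w zero) (suc c) ≡ b₁ → eqF (w (suc zero)) (suc c) ≡ b₂ →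
    eqF (w lastPos) zero ≡ b₃ → flip c w ≡ flipBy b₁ b₂ b₃ c w
  flip-cases c w refl refl refl = refl

  flipBy-cong : ∀ b₁ b₂ b₃ c {w v} → (∀ x → w x ≡ v x) → ∀ x → flipBy b₁ b₂ b₃ c w x ≡ flipBy b₁ b₂ b₃ c v x
  flipBy-cong true  true  b₃    c e x       = e x
  flipBy-cong true  false b₃    c e x       = shiftL-cong (e ∘ suc) x
  flipBy-cong false b₂    true  c e zero    = refl
  flipBy-cong false b₂    true  c e (suc x) = e (inject₁ x)
  flipBy-cong false b₂    false c e x       = e x

  flip-cong : ∀ c {w v} → (∀ x → w x ≡ v x) → ∀ x → flip c w x ≡ flip c v x
  flip-cong c {w} {v} e x =
    trans (flipBy-cong (eqF (w zero) (suc c)) (eqF (w (suc zero)) (suc c)) (eqF (w lastPos) zero) c e x)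
      (cong (λ z → z x) (esym (flip-cases c v (tests (e zero)) (tests (e (suc zero))) (cong (λ z → eqF z zero) (esym (e lastPos))))))
    where
    tests : ∀ {a b} → a ≡ b → eqF b (suc c) ≡ eqF a (suc c)
    tests a≡b = cong (λ z → eqF z (suc c)) (esym a≡b)

  flipBy-involutive : ∀ c w b₁ b₂ b₃ → eqF (w zero) (suc c) ≡ b₁ → eqF (w (suc zero)) (suc c) ≡ b₂ →
    eqF (w lastPos) zero ≡ b₃ → ∀ x → flip c (flipBy b₁ b₂ b₃ c w) x ≡ w x
  flipBy-involutive c w true  true  b₃ e₁ e₂ e₃ x = cong (λ z → z x) (flip-cases c w e₁ e₂ e₃)
  flipBy-involutive c w true  false b₃ e₁ e₂ e₃ x =
    trans (cong (λ z → z x) (flip-cases c (pop w) e₂ refl (cong (λ z → eqF z zero) (shiftL-last (w ∘ suc)))))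
          (push-pop c w (eqF-sound _ _ e₁) x)
  flipBy-involutive c w false b₂ true  e₁ e₂ e₃ x =
    trans (cong (λ z → z x) (flip-cases c (push c w) (eqF-refl (suc c)) e₁ refl))
          (pop-push c w (eqF-sound _ _ e₃) x)
  flipBy-involutive c w false b₂ false e₁ e₂ e₃ x = cong (λ z → z x) (flip-cases c w e₁ e₂ e₃)

  flip-involutive : ∀ c w x → flip c (flip c w) x ≡ w x
  flip-involutive c w = flipBy-involutive c w _ _ _ refl refl refl

  flip-push : ∀ c w → w zero ≢ suc c → w lastPos ≡ zero → ∀ x → flip c w x ≡ push c w x
  flip-push c w w₀≢c room x = cong (λ z → z x) (flip-cases c w (eqF-false _ _ w₀≢c) refl (cong (λ z → eqF z zero) room))

  codeCount : ℕ
  codeCount = suc K ^ len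

  Code : Set
  Code = Fin codeCount

  word : Code → Word
  word = finToFun

  σ : Fin K → Code → Code
  σ c x = funToFin (flip c (word x))

  emptyWord : Code
  emptyWord = funToFin {len} {suc K} (λ _ → zero)

  word-σ : ∀ c x i → word (σ c x) i ≡ flip c (word x) i
  word-σ c x = FP.finToFun-funToFin (flip c (word x))

  word-empty : ∀ i → word emptyWord i ≡ zero
  word-empty = FP.finToFun-funToFin {len} {suc K} (λ _ → zero)

  σ-involutive : ∀ c x → σ c (σ c x) ≡ x
  σ-involutive c x =
    trans (funToFin-cong (λ i → trans (flip-cong c (word-σ c x) i) (flip-involutive c (word x) i)))
          (FP.funToFin-finToFin {len} {suc K} x)

  σ-injective : ∀ c x y → σ c x ≡ σ c y → x ≡ y
  σ-injective c x y e = trans (esym (σ-involutive c x)) (trans (cong (σ c) e) (σ-involutive c y))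

  σ-push : ∀ c x → word x zero ≢ suc c → word x lastPos ≡ zero → ∀ i → word (σ c x) i ≡ push c (word x) i
  σ-push c x w₀≢c room i = trans (word-σ c x i) (flip-push c (word x) w₀≢c room i)

  σ-empty-head : ∀ c → word (σ c emptyWord) zero ≡ suc c
  σ-empty-head c = σ-push c emptyWord (λ e → FP.0≢1+n (trans (esym (word-empty zero)) e)) (word-empty lastPos) zero

  σ-moves-empty : ∀ c → σ c emptyWord ≢ emptyWord
  σ-moves-empty c e = FP.0≢1+n (trans (esym (word-empty zero)) (trans (cong (λ z → word z zero) (esym e)) (σ-empty-head c)))

-- The lift of a graph G of maximum degree at most d (see the opening
-- comment); g is the girth to be preserved and fixes the word length.
module Lift (G : Graph) (d g : ℕ) (deg≤d : ∀ v → degree G v ≤ d) where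
  -- Colours are the pairs (u , s) of a vertex u and a slot s < d.
  open Words (n G * d) g public

  colour : Fin (n G) → Fin d → Fin (n G * d)
  colour = combine

  -- Layers are the injective self-maps (permutations) of the word codes,
  -- enumerated by Fin layerCount.
  abstract
    mapCount : ℕ
    mapCount = codeCount ^ codeCount

    mapAt : Fin mapCount → Code → Code
    mapAt = finToFun

    injective? : (f : Code → Code) → Dec (∀ x y → f x ≡ f y → x ≡ y)
    injective? f = FP.all? λ x → FP.all? λ y → (f x FP.≟ f y) →-dec (x FP.≟ y)

    isPermutation : Fin mapCount → Bool
    isPermutation r = does (injective? (mapAt r))

    layerCount : ℕ
    layerCount = count isPermutation

    perm : Fin layerCount → Code → Code
    perm q = mapAt (enum isPermutation q)

    perm-injective : ∀ q x y → perm q x ≡ perm q y → x ≡ y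
    perm-injective q = decided (injective? (perm q)) (enum-sat isPermutation q)

    perm-ext : ∀ q q' → (∀ x → perm q x ≡ perm q' x) → q ≡ q'
    perm-ext q q' e = enum-injective isPermutation q q'
      (trans (esym (FP.funToFin-finToFin {codeCount} {codeCount} (enum isPermutation q)))
        (trans (funToFin-cong e) (FP.funToFin-finToFin {codeCount} {codeCount} (enum isPermutation q'))))

    permLayer : (h : Code → Code) → (∀ x y → h x ≡ h y → x ≡ y) → Σ (Fin layerCount) λ q → ∀ x → perm q x ≡ h x
    permLayer h h-inj = q , λ x → trans (cong (λ r → mapAt r x) enum-q≡r) (FP.finToFun-funToFin h x)
      where
      r : Fin mapCount
      r = funToFin h
      mapAt-r : ∀ x → mapAt r x ≡ h x
      mapAt-r = FP.finToFun-funToFin h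
      r-perm : isPermutation r ≡ true
      r-perm = dec-true (injective? (mapAt r)) λ x y e →
        h-inj x y (trans (esym (mapAt-r x)) (trans e (mapAt-r y)))
      q : Fin (count isPermutation)
      q = proj₁ (enum-surjective isPermutation r r-perm)
      enum-q≡r : enum isPermutation q ≡ r
      enum-q≡r = proj₂ (enum-surjective isPermutation r r-perm)

    _⋆_ : Fin layerCount → Fin (n G * d) → Fin layerCount
    q ⋆ c = proj₁ (permLayer (perm q ∘ σ c) λ x y e → σ-injective c x y (perm-injective q _ _ e))

    perm-⋆ : ∀ q c x → perm (q ⋆ c) x ≡ perm q (σ c x)
    perm-⋆ q c = proj₂ (permLayer (perm q ∘ σ c) λ x y e → σ-injective c x y (perm-injective q _ _ e))

    ⋆-involutive : ∀ q q' c → q' ≡ q ⋆ c → q ≡ q' ⋆ c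
    ⋆-involutive q q' c e = perm-ext q (q' ⋆ c) λ x → esym (begin
      perm (q' ⋆ c) x        ≡⟨ perm-⋆ q' c x ⟩
      perm q' (σ c x)        ≡⟨ cong (λ z → perm z (σ c x)) e ⟩
      perm (q ⋆ c) (σ c x)   ≡⟨ perm-⋆ q c (σ c x) ⟩
      perm q (σ c (σ c x))   ≡⟨ cong (perm q) (σ-involutive c x) ⟩
      perm q x ∎)
      where open ≡-Reasoning

    ⋆-moves : ∀ q c → q ≢ q ⋆ c
    ⋆-moves q c e = σ-moves-empty c (esym (perm-injective q _ _ (trans (cong (λ z → perm z emptyWord) e) (perm-⋆ q c emptyWord))))

    ⋆-injective : ∀ q a b → q ⋆ a ≡ q ⋆ b → a ≡ b
    ⋆-injective q a b e = FP.suc-injective (trans (esym (σ-empty-head a)) (trans (cong (λ z → word z zero) σa≡σb) (σ-empty-head b)))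
      where
      σa≡σb : σ a emptyWord ≡ σ b emptyWord
      σa≡σb = perm-injective q _ _ (trans (esym (perm-⋆ q a emptyWord)) (trans (cong (λ z → perm z emptyWord) e) (perm-⋆ q b emptyWord)))

    idLayer : Fin layerCount
    idLayer = proj₁ (permLayer id (λ x y e → e))

  deficiency : Fin (n G) → ℕ
  deficiency u = d ∸ degree G u

  fibreStep : Fin (n G) → Fin layerCount → Fin layerCount → Fin d → Bool
  fibreStep u q q' s = eqF (q ⋆ colour u s) q' ∧ (toℕ s <ᵇ deficiency u)

  fibreAdj : Fin (n G) → Fin layerCount → Fin layerCount → Bool
  fibreAdj u q q' = anyF (fibreStep u q q')

  liftAdj : Fin (n G) → Fin layerCount → Fin (n G) → Fin layerCount → Bool
  liftAdj u q u' q' = (eqF q q' ∧ adj G u u') ∨ (eqF u u' ∧ fibreAdj u q q')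

  -- The adjacency of H is symmetric and irreflexive because each ⋆ c is
  -- an involution without fixed points.
  fibreAdj-sym : ∀ u q q' → fibreAdj u q q' ≡ fibreAdj u q' q
  fibreAdj-sym u q q' = anyF-cong λ s → cong (_∧ (toℕ s <ᵇ deficiency u))
    (eqF-iff (λ e → esym (⋆-involutive q q' (colour u s) (esym e)))
             (λ e → esym (⋆-involutive q' q (colour u s) (esym e))))

  liftAdj-sym : ∀ u q u' q' → liftAdj u q u' q' ≡ liftAdj u' q' u q
  liftAdj-sym u q u' q' = cong₂ _∨_ (cong₂ _∧_ (eqF-sym q q') (Graph.sym G u u')) (fibrePart (eqF u u') refl)
    where
    fibrePart : ∀ b → eqF u u' ≡ b → (b ∧ fibreAdj u q q') ≡ (eqF u' u ∧ fibreAdj u' q' q)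
    fibrePart true  e rewrite eqF-sound u u' e | eqF-refl u' = fibreAdj-sym u' q q'
    fibrePart false e rewrite eqF-sym u' u | e = refl

  liftAdj-irrefl : ∀ u q → liftAdj u q u q ≡ false
  liftAdj-irrefl u q rewrite eqF-refl q | eqF-refl u | Graph.irrefl G u =
    anyF-false _ λ s → cong (_∧ (toℕ s <ᵇ deficiency u)) (eqF-false _ _ λ e → ⋆-moves q (colour u s) (esym e))

  baseOf : Fin (n G * layerCount) → Fin (n G)
  baseOf x = proj₁ (remQuot {n G} layerCount x)

  layerOf : Fin (n G * layerCount) → Fin layerCount
  layerOf x = proj₂ (remQuot {n G} layerCount x)

  H : Graph
  H = record
    { n      = n G * layerCount
    ; adj    = λ x y → liftAdj (baseOf x) (layerOf x) (baseOf y) (layerOf y)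
    ; sym    = λ x y → liftAdj-sym (baseOf x) (layerOf x) (baseOf y) (layerOf y)
    ; irrefl = λ x → liftAdj-irrefl (baseOf x) (layerOf x)
    }

  pair : Fin (n G) → Fin layerCount → Fin (n H)
  pair = combine

  adj-pair : ∀ u q u' q' → adj H (pair u q) (pair u' q') ≡ liftAdj u q u' q'
  adj-pair u q u' q' = cong₂ (λ a b → liftAdj (proj₁ a) (proj₂ a) (proj₁ b) (proj₂ b))
    (FP.remQuot-combine {n G} {layerCount} u q) (FP.remQuot-combine {n G} {layerCount} u' q')

  pair-decode : ∀ x → pair (baseOf x) (layerOf x) ≡ x
  pair-decode = FP.combine-remQuot {n G} layerCount

  -- Each vertex (u , q) has exactly deficiency u fibre-neighbours: the
  -- layers q ⋆ colour u s for the slots s < deficiency u, which are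
  -- pairwise distinct.
  fibreDegree : ∀ u q → sumFin (λ q' → bit (fibreAdj u q q')) ≡ deficiency u
  fibreDegree u q = begin
    sumFin (λ q' → bit (fibreAdj u q q'))
      ≡⟨ sumFin-cong (λ q' → anyF-unique (fibreStep u q q') (slot-unique q')) ⟩
    sumFin (λ q' → sumFin (λ s → bit (fibreStep u q q' s)))
      ≡⟨ sumFin-swap (λ q' s → bit (fibreStep u q q' s)) ⟩
    sumFin (λ s → sumFin (λ q' → bit (fibreStep u q q' s)))
      ≡⟨ sumFin-cong (λ s → count-point (q ⋆ colour u s) (toℕ s <ᵇ deficiency u)) ⟩
    count {d} (λ s → toℕ s <ᵇ deficiency u)
      ≡⟨ count-below d (deficiency u) (NP.m∸n≤m d (degree G u)) ⟩
    deficiency u ∎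
    where
    open ≡-Reasoning
    slot-unique : ∀ q' s s' → fibreStep u q q' s ≡ true → fibreStep u q q' s' ≡ true → s ≡ s'
    slot-unique q' s s' e e' = FP.combine-injectiveʳ u s u s' (⋆-injective q _ _
      (trans (eqF-sound _ _ (proj₁ (∧-true e))) (esym (eqF-sound _ _ (proj₁ (∧-true e'))))))

  neighboursOver : ∀ u q u' →
    sumFin (λ q' → bit (liftAdj u q u' q')) ≡ bit (adj G u u') + (if eqF u u' then deficiency u else 0)
  neighboursOver u q u' = begin
    sumFin (λ q' → bit (liftAdj u q u' q'))
      ≡⟨ sumFin-cong (λ q' → bit-∨ (eqF q q' ∧ adj G u u') (eqF u u' ∧ fibreAdj u q q') (disjoint q')) ⟩
    sumFin (λ q' → bit (eqF q q' ∧ adj G u u') + bit (eqF u u' ∧ fibreAdj u q q'))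
      ≡⟨ sumFin-+ (λ q' → bit (eqF q q' ∧ adj G u u')) (λ q' → bit (eqF u u' ∧ fibreAdj u q q')) ⟩
    sumFin (λ q' → bit (eqF q q' ∧ adj G u u')) + sumFin (λ q' → bit (eqF u u' ∧ fibreAdj u q q'))
      ≡⟨ cong₂ _+_ (count-point q (adj G u u')) (fibrePart (eqF u u')) ⟩
    bit (adj G u u') + (if eqF u u' then deficiency u else 0) ∎
    where
    open ≡-Reasoning
    disjoint : ∀ q' → (eqF q q' ∧ adj G u u') ≡ true → (eqF u u' ∧ fibreAdj u q q') ≡ true → ⊥
    disjoint q' e₁ e₂ = false≢true (trans (esym (Graph.irrefl G u))
      (trans (cong (adj G u) (eqF-sound _ _ (proj₁ (∧-true e₂)))) (proj₂ (∧-true e₁))))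
    fibrePart : ∀ b → sumFin (λ q' → bit (b ∧ fibreAdj u q q')) ≡ (if b then deficiency u else 0)
    fibrePart true  = fibreDegree u q
    fibrePart false = sumFin-zero {layerCount} _ (λ _ → refl)

  regular : Regular H d
  regular x = begin
    SS.∣ tabulate (adj H x) ∣
      ≡⟨ size-tabulate (adj H x) ⟩
    count (adj H x)
      ≡⟨ sumFin-combine {n G} {layerCount} (bit ∘ adj H x) ⟩
    sumFin (λ u' → sumFin (λ q' → bit (adj H x (pair u' q'))))
      ≡⟨ sumFin-cong (λ u' → sumFin-cong (λ q' → cong (λ z → bit (adj H z (pair u' q'))) (esym (pair-decode x)))) ⟩
    sumFin (λ u' → sumFin (λ q' → bit (adj H (pair u q) (pair u' q'))))
      ≡⟨ sumFin-cong (λ u' → sumFin-cong (λ q' → cong bit (adj-pair u q u' q'))) ⟩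
    sumFin (λ u' → sumFin (λ q' → bit (liftAdj u q u' q')))
      ≡⟨ sumFin-cong (neighboursOver u q) ⟩
    sumFin (λ u' → bit (adj G u u') + (if eqF u u' then deficiency u else 0))
      ≡⟨ sumFin-+ (λ u' → bit (adj G u u')) (λ u' → if eqF u u' then deficiency u else 0) ⟩
    count (adj G u) + sumFin (λ u' → if eqF u u' then deficiency u else 0)
      ≡⟨ cong₂ _+_ (esym (size-tabulate (adj G u))) (sumFin-point u (λ _ → deficiency u)) ⟩
    degree G u + (d ∸ degree G u)
      ≡⟨ NP.m+[n∸m]≡n (deg≤d u) ⟩
    d ∎
    where
    open ≡-Reasoning
    u = baseOf x
    q = layerOf x

  layerAdj : ∀ q u u' → Adj G u u' → Adj H (pair u q) (pair u' q)
  layerAdj q u u' e = trans (adj-pair u q u' q)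
    (trans (cong (λ z → (z ∧ adj G u u') ∨ (eqF u u' ∧ fibreAdj u q q)) (eqF-refl q))
           (cong (_∨ (eqF u u' ∧ fibreAdj u q q)) e))

  layerIndependent : ∀ S → Independent H S → ∀ q → Independent G (tabulate (λ u → lookup S (pair u q)))
  layerIndependent S ind q i j i∈ j∈ = ind (pair i q) (pair j q) (inLayer i i∈) (inLayer j j∈) ∘ layerAdj q i j
    where
    inLayer : ∀ u → u SS.∈ tabulate (λ u → lookup S (pair u q)) → pair u q SS.∈ S
    inLayer u u∈ = VP.lookup⇒[]= _ S (trans (esym (VP.lookup∘tabulate _ u)) (VP.[]=⇒lookup u∈))

  independence-bound : ∀ a → (∀ T → Independent G T → SS.∣ T ∣ ≤ a) → ∀ S → Independent H S → SS.∣ S ∣ ≤ layerCount * a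
  independence-bound a α-max S ind = NP.≤-trans (NP.≤-reflexive by-layers) (sumFin-≤ _ a λ q →
      NP.≤-trans (NP.≤-reflexive (esym (size-tabulate (λ u → lookup S (pair u q)))))
                 (α-max _ (layerIndependent S ind q)))
    where
    by-layers : SS.∣ S ∣ ≡ sumFin {layerCount} (λ q → count (λ u → lookup S (pair u q)))
    by-layers = trans (size-lookup S) (trans (sumFin-combine {n G} {layerCount} (bit ∘ lookup S))
                  (sumFin-swap (λ u q → bit (lookup S (pair u q)))))

  liftCycle : ∀ k → HasCycleOfLength G k → HasCycleOfLength H k
  liftCycle (suc m) (3≤ , f , f-inj , steps , closes) =
    3≤ , (λ i → pair (f i) idLayer) , (λ {i} {j} e → f-inj (FP.combine-injectiveˡ (f i) idLayer (f j) idLayer e)) ,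
    (λ i → layerAdj idLayer _ _ (steps i)) , layerAdj idLayer _ _ closes

  LayerEdge FibreEdge : Fin (n H) → Fin (n H) → Set
  LayerEdge x y = layerOf x ≡ layerOf y × Adj G (baseOf x) (baseOf y)
  FibreEdge x y = baseOf x ≡ baseOf y × Σ (Fin d) λ s → layerOf y ≡ layerOf x ⋆ colour (baseOf x) s

  edgeKind : ∀ {x y} → Adj H x y → LayerEdge x y ⊎ FibreEdge x y
  edgeKind {x} {y} e with ∨-true {eqF (layerOf x) (layerOf y) ∧ adj G (baseOf x) (baseOf y)} e
  ... | inj₁ e₁ = inj₁ (eqF-sound _ _ (proj₁ (∧-true e₁)) , proj₂ (∧-true e₁))
  ... | inj₂ e₂ = let (s , es) = anyF-sound _ (proj₂ (∧-true e₂)) in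
    inj₂ (eqF-sound _ _ (proj₁ (∧-true e₂)) , s , esym (eqF-sound _ _ (proj₁ (∧-true es))))

  perm-⋆-σ : ∀ q q' c x → q' ≡ q ⋆ c → perm q' (σ c x) ≡ perm q x
  perm-⋆-σ q q' c x q'≡ = begin
    perm q' (σ c x)          ≡⟨ cong (λ z → perm z (σ c x)) q'≡ ⟩
    perm (q ⋆ c) (σ c x)     ≡⟨ perm-⋆ q c (σ c x) ⟩
    perm q (σ c (σ c x))     ≡⟨ cong (perm q) (σ-involutive c x) ⟩
    perm q x ∎
    where open ≡-Reasoning

  -- Walking
  -- along the cycle we track a word ρ with perm (current layer) ρ fixed;
  -- each fibre step by colour c replaces ρ by σ c ρ.  Consecutive fibre
  -- steps never cancel (that would revisit a vertex), so once the walk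
  -- has left its starting layer ρ is a nonempty word beginning with the
  -- last colour used, and it never fills up since m < g.  Closing the
  -- cycle then forces ρ to be empty, or to cancel the first step.
  module ShortCycle (noShortG : ∀ k → k < g → ¬ HasCycleOfLength G k)
                    (m : ℕ) (short : suc m < g) (3≤ : 3 ≤ suc m)
                    (f : Fin (suc m) → Fin (n H)) (f-inj : Injective _≡_ _≡_ f)
                    (steps : ∀ (i : Fin m) → Adj H (f (inject₁ i)) (f (suc i)))
                    (closes : Adj H (f (fromℕ m)) (f zero)) where

    at : (j : ℕ) → .(j ≤ m) → Fin (n H)
    at j p = f (fromℕ< (s≤s p))

    base : (j : ℕ) → .(j ≤ m) → Fin (n G)
    base j p = baseOf (at j p)

    layer : (j : ℕ) → .(j ≤ m) → Fin layerCount
    layer j p = layerOf (at j p)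

    startLayer : Fin layerCount
    startLayer = layer 0 z≤n

    position-unique : ∀ i j .(p : i ≤ m) .(p' : j ≤ m) → base i p ≡ base j p' → layer i p ≡ layer j p' → i ≡ j
    position-unique i j p p' b≡ l≡ =
      trans (esym (FP.toℕ-fromℕ< (s≤s p))) (trans (cong toℕ (f-inj same-vertex)) (FP.toℕ-fromℕ< (s≤s p')))
      where
      same-vertex : at i p ≡ at j p'
      same-vertex = trans (esym (pair-decode (at i p))) (trans (cong₂ pair b≡ l≡) (pair-decode (at j p')))

    consecutive : ∀ j (p : suc j ≤ m) → Adj H (at j (NP.<⇒≤ p)) (at (suc j) p)
    consecutive j p = subst (λ z → Adj H (f z) (at (suc j) p))
      (FP.toℕ-injective (trans (FP.toℕ-inject₁ (fromℕ< p)) (trans (FP.toℕ-fromℕ< p) (esym (FP.toℕ-fromℕ< (s≤s (NP.<⇒≤ p)))))))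
      (steps (fromℕ< p))

    closing : Adj H (at m NP.≤-refl) (at 0 z≤n)
    closing = subst (λ z → Adj H (f z) (f zero))
      (FP.toℕ-injective (trans (FP.toℕ-fromℕ m) (esym (FP.toℕ-fromℕ< (s≤s (NP.≤-refl {m}))))))
      closes

    InStartLayer : (j : ℕ) → j ≤ m → Code → Set
    InStartLayer j p ρ = (ρ ≡ emptyWord) × (∀ i (i≤j : i ≤ j) → layer i (NP.≤-trans i≤j p) ≡ startLayer)

    -- The last fibre step before position j went from ℓ to suc ℓ at the
    -- base vertex u with slot s, and the walk stayed in one layer since;
    -- ρ begins with that colour and has at most j letters.
    record AfterFibreStep (j : ℕ) (p : j ≤ m) (ρ : Code) : Set where
      field
        ℓ        : ℕ
        ℓ<j      : suc ℓ ≤ j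
        u        : Fin (n G)
        slot     : Fin d
        filled   : ℕ
        filled≤j : filled ≤ j
        head     : word ρ zero ≡ suc (colour u slot)
        blank    : ∀ i → filled ≤ toℕ i → word ρ i ≡ zero
        base-ℓ   : base ℓ (NP.≤-trans (NP.n≤1+n ℓ) (NP.≤-trans ℓ<j p)) ≡ u
        base-1+ℓ : base (suc ℓ) (NP.≤-trans ℓ<j p) ≡ u
        crossing : layer (suc ℓ) (NP.≤-trans ℓ<j p) ≡ layer ℓ (NP.≤-trans (NP.n≤1+n ℓ) (NP.≤-trans ℓ<j p)) ⋆ colour u slot
        stayed   : layer (suc ℓ) (NP.≤-trans ℓ<j p) ≡ layer j p

    State : (j : ℕ) → j ≤ m → Code → Set
    State j p ρ = InStartLayer j p ρ ⊎ AfterFibreStep j p ρ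

    record Tracked (j : ℕ) (p : j ≤ m) : Set where
      constructor tracked
      field
        ρ      : Code
        tracks : perm (layer j p) ρ ≡ perm startLayer emptyWord
        state  : State j p ρ

    room : ∀ t j → t ≤ j → suc j ≤ m → t ≤ toℕ lastPos
    room t j t≤j j<m = subst (t ≤_) (esym (FP.toℕ-fromℕ (suc g)))
      (NP.≤-trans t≤j (NP.≤-trans (NP.n≤1+n j) (NP.≤-trans j<m
        (NP.≤-trans (NP.n≤1+n m) (NP.≤-trans (NP.<⇒≤ short) (NP.n≤1+n g))))))

    backtrack : ∀ {j i ρ} (p : j ≤ m) .(p' : i ≤ m) (A : AfterFibreStep j p ρ) → let open AfterFibreStep A in
      base j p ≡ u → base i p' ≡ u → layer i p' ≡ layer j p ⋆ colour u slot → j ≡ suc ℓ × i ≡ ℓ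
    backtrack {j} {i} p p' A bj bi li =
      position-unique j (suc ℓ) p (NP.≤-trans ℓ<j p) (trans bj (esym base-1+ℓ)) (esym stayed) ,
      position-unique i ℓ p' (NP.≤-trans (NP.n≤1+n ℓ) (NP.≤-trans ℓ<j p)) (trans bi (esym base-ℓ))
        (trans li (trans (cong (_⋆ colour u slot) (esym stayed)) (esym (⋆-involutive _ _ _ crossing))))
      where open AfterFibreStep A

    pushFibre : ∀ j (p : suc j ≤ m) ρ s →
      base j (NP.<⇒≤ p) ≡ base (suc j) p →
      layer (suc j) p ≡ layer j (NP.<⇒≤ p) ⋆ colour (base j (NP.<⇒≤ p)) s →
      word ρ zero ≢ suc (colour (base j (NP.<⇒≤ p)) s) →
      ∀ t → t ≤ j → (∀ i → t ≤ toℕ i → word ρ i ≡ zero) →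
      AfterFibreStep (suc j) p (σ (colour (base j (NP.<⇒≤ p)) s) ρ)
    pushFibre j p ρ s b≡ crossed new t t≤j blank = record
      { ℓ = j ; ℓ<j = NP.≤-refl ; u = base j (NP.<⇒≤ p) ; slot = s
      ; filled = suc t ; filled≤j = s≤s t≤j
      ; head = σ-push c ρ new full zero
      ; blank = blank'
      ; base-ℓ = refl ; base-1+ℓ = esym b≡ ; crossing = crossed ; stayed = refl }
      where
      c = colour (base j (NP.<⇒≤ p)) s
      full : word ρ lastPos ≡ zero
      full = blank lastPos (room t j t≤j p)
      blank' : ∀ i → suc t ≤ toℕ i → word (σ c ρ) i ≡ zero
      blank' (suc i) (s≤s t≤i) = trans (σ-push c ρ new full (suc i)) (blank (inject₁ i) (subst (t ≤_) (esym (FP.toℕ-inject₁ i)) t≤i))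

    layerState : ∀ j (p : suc j ≤ m) ρ → layer j (NP.<⇒≤ p) ≡ layer (suc j) p → State j (NP.<⇒≤ p) ρ → State (suc j) p ρ
    layerState j p ρ same (inj₁ (empty , all)) = inj₁ (empty , extend)
      where
      extend : ∀ i (i≤1+j : i ≤ suc j) → layer i (NP.≤-trans i≤1+j p) ≡ startLayer
      extend i i≤1+j with NP.m≤n⇒m<n∨m≡n i≤1+j
      ... | inj₁ i<1+j = all i (NP.≤-pred i<1+j)
      ... | inj₂ refl  = trans (esym same) (all j NP.≤-refl)
    layerState j p ρ same (inj₂ A) = inj₂ (record
      { ℓ = ℓ ; ℓ<j = NP.≤-trans ℓ<j (NP.n≤1+n j) ; u = u ; slot = slot
      ; filled = filled ; filled≤j = NP.≤-trans filled≤j (NP.n≤1+n j)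
      ; head = head ; blank = blank ; base-ℓ = base-ℓ ; base-1+ℓ = base-1+ℓ
      ; crossing = crossing ; stayed = trans stayed same })
      where open AfterFibreStep A

    fibreState : ∀ j (p : suc j ≤ m) ρ s →
      base j (NP.<⇒≤ p) ≡ base (suc j) p →
      layer (suc j) p ≡ layer j (NP.<⇒≤ p) ⋆ colour (base j (NP.<⇒≤ p)) s →
      State j (NP.<⇒≤ p) ρ → State (suc j) p (σ (colour (base j (NP.<⇒≤ p)) s) ρ)
    fibreState j p .emptyWord s b≡ crossed (inj₁ (refl , _)) =
      inj₂ (pushFibre j p emptyWord s b≡ crossed (λ e → FP.0≢1+n (trans (esym (word-empty zero)) e))
              0 z≤n (λ i _ → word-empty i))
    fibreState j p ρ s b≡ crossed (inj₂ A) with colour (base j (NP.<⇒≤ p)) s FP.≟ colour (AfterFibreStep.u A) (AfterFibreStep.slot A)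
    ... | no new = inj₂ (pushFibre j p ρ s b≡ crossed (λ e → new (FP.suc-injective (trans (esym e) head)))
                      filled filled≤j blank)
      where open AfterFibreStep A
    ... | yes same = ⊥-elim (n≢2+n ℓ (trans (esym 1+j≡ℓ) (cong suc j≡1+ℓ)))
      where
      open AfterFibreStep A
      bj : base j (NP.<⇒≤ p) ≡ u
      bj = FP.combine-injectiveˡ _ s u slot same
      retrace : j ≡ suc ℓ × suc j ≡ ℓ
      retrace = backtrack (NP.<⇒≤ p) p A bj (trans (esym b≡) bj) (trans crossed (cong (_ ⋆_) same))
      j≡1+ℓ = proj₁ retrace
      1+j≡ℓ = proj₂ retrace

    advance : ∀ j (p : suc j ≤ m) → Tracked j (NP.<⇒≤ p) → Tracked (suc j) p
    advance j p (tracked ρ tracks st) with edgeKind (consecutive j p)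
    ... | inj₁ (same , _) = tracked ρ (trans (cong (λ z → perm z ρ) (esym same)) tracks) (layerState j p ρ same st)
    ... | inj₂ (b≡ , s , crossed) =
      tracked (σ (colour (base j (NP.<⇒≤ p)) s) ρ) (trans (perm-⋆-σ _ _ _ ρ crossed) tracks)
              (fibreState j p ρ s b≡ crossed st)

    trackAll : ∀ j (p : j ≤ m) → Tracked j p
    trackAll zero    z≤n = tracked emptyWord refl (inj₁ (refl , λ { zero z≤n → refl }))
    trackAll (suc j) p   = advance j p (trackAll j (NP.<⇒≤ p))

    projectCycle : (∀ i (i≤m : i ≤ m) → layer i (NP.≤-trans i≤m NP.≤-refl) ≡ startLayer) → ⊥
    projectCycle all = noShortG (suc m) short
      (3≤ , (λ i → baseOf (f i)) , project-inj , (λ i → inLayer (steps i)) , inLayer closes)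
      where
      all' : ∀ i → layerOf (f i) ≡ startLayer
      all' i = trans (cong (λ z → layerOf (f z)) (esym (FP.fromℕ<-toℕ i (FP.toℕ<n i)))) (all (toℕ i) (NP.≤-pred (FP.toℕ<n i)))
      inLayer : ∀ {i i'} → Adj H (f i) (f i') → Adj G (baseOf (f i)) (baseOf (f i'))
      inLayer {i} {i'} e with edgeKind e
      ... | inj₁ (_ , a) = a
      ... | inj₂ (_ , s , crossed) = ⊥-elim (⋆-moves startLayer _
              (trans (esym (all' i')) (trans crossed (cong (_⋆ colour (baseOf (f i)) s) (all' i)))))
      project-inj : Injective _≡_ _≡_ (λ i → baseOf (f i))
      project-inj {i} {i'} e = f-inj (trans (esym (pair-decode (f i)))
        (trans (cong₂ pair e (trans (all' i) (esym (all' i')))) (pair-decode (f i'))))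

    -- Closing by a layer edge: ρ must be empty again.
    closeInLayer : ∀ ρ → layer m NP.≤-refl ≡ startLayer → perm (layer m NP.≤-refl) ρ ≡ perm startLayer emptyWord →
      State m NP.≤-refl ρ → ⊥
    closeInLayer ρ same tracks (inj₁ (_ , all)) = projectCycle all
    closeInLayer ρ same tracks (inj₂ A) =
      FP.0≢1+n (trans (esym (word-empty zero)) (trans (cong (λ z → word z zero) (esym ρ≡empty)) head))
      where
      open AfterFibreStep A
      ρ≡empty : ρ ≡ emptyWord
      ρ≡empty = perm-injective startLayer _ _ (trans (cong (λ z → perm z ρ) (esym same)) tracks)

    -- Closing by a fibre edge: ρ must be a single colour, which then
    -- cancels the first step of the cycle.
    closeByFibre : ∀ ρ s → base m NP.≤-refl ≡ base 0 z≤n → startLayer ≡ layer m NP.≤-refl ⋆ colour (base m NP.≤-refl) s →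
      perm (layer m NP.≤-refl) ρ ≡ perm startLayer emptyWord → State m NP.≤-refl ρ → ⊥
    closeByFibre ρ s b≡ crossed tracks st = finish st
      where
      c = colour (base m NP.≤-refl) s
      ρ≡σc : ρ ≡ σ c emptyWord
      ρ≡σc = perm-injective (layer m NP.≤-refl) _ _ (trans tracks (esym (perm-⋆-σ startLayer (layer m NP.≤-refl) c emptyWord (⋆-involutive _ _ _ crossed))))
      finish : State m NP.≤-refl ρ → ⊥
      finish (inj₁ (ρ≡empty , _)) = σ-moves-empty c (trans (esym ρ≡σc) ρ≡empty)
      finish (inj₂ A) = NP.<-irrefl refl (NP.≤-trans 3≤ (NP.≤-reflexive (cong suc m≡1)))
        where
        open AfterFibreStep A
        same : c ≡ colour u slot
        same = FP.suc-injective (trans (esym (σ-empty-head c)) (trans (cong (λ z → word z zero) (esym ρ≡σc)) head))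
        bm : base m NP.≤-refl ≡ u
        bm = FP.combine-injectiveˡ _ s u slot same
        retrace : m ≡ suc ℓ × 0 ≡ ℓ
        retrace = backtrack NP.≤-refl z≤n A bm (trans (esym b≡) bm) (trans crossed (cong (_ ⋆_) same))
        m≡1 : m ≡ 1
        m≡1 = trans (proj₁ retrace) (cong suc (esym (proj₂ retrace)))

    impossible : ⊥
    impossible with trackAll m NP.≤-refl | edgeKind closing
    ... | tracked ρ tracks st | inj₁ (same , _) = closeInLayer ρ same tracks st
    ... | tracked ρ tracks st | inj₂ (b≡ , s , crossed) = closeByFibre ρ s b≡ crossed tracks st

  girth : Girth G g → Girth H g
  girth (cycle , noShortG) = liftCycle g cycle , noShort
    where
    noShort : ∀ k → k < g → ¬ HasCycleOfLength H k
    noShort (suc m) short (3≤ , f , f-inj , steps , closes) =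
      ShortCycle.impossible noShortG m short 3≤ f f-inj steps closes

cycleVertex : ∀ G k → HasCycleOfLength G k → Fin (n G)
cycleVertex G (suc m) (_ , f , _) = f zero

-- |V(H)| = |V(G)| · layerCount and α(H) ≤ layerCount · α(G), so the
-- ratio of H bounds the ratio of G from above.
corollary2p8 : (d g : ℕ) → 2 < d → 2 < g → (B : ℚ) →
    (∀ (G : Graph) → Regular G d → Girth G g → IndependenceRatioAtLeast G B) →
    ∀ (G : Graph) → MaxDegree G d → Girth G g → IndependenceRatioAtLeast G B
corollary2p8 d g _ _ B regularBound G (deg≤d , _) girthG a αG =
  QP.≤-trans B≤ratioH (ratio-≤ (L.pair v L.idLayer) v cross-multiplied)
  where
  module L = Lift G d g deg≤d
  v : Fin (n G)
  v = cycleVertex G g (proj₁ girthG)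
  αH : Σ ℕ (IsIndependenceNumber L.H)
  αH = independenceNumber L.H
  B≤ratioH : B Q.≤ ratio (proj₁ αH) (n L.H)
  B≤ratioH = regularBound L.H L.regular (L.girth girthG) (proj₁ αH) (proj₂ αH)
  αH≤ : proj₁ αH ≤ L.layerCount * a
  αH≤ = let (S , indS , ∣S∣≡αH) = proj₁ (proj₂ αH) in
    subst (_≤ L.layerCount * a) ∣S∣≡αH (L.independence-bound a (proj₂ αG) S indS)
  cross-multiplied : proj₁ αH * n G ≤ a * (n G * L.layerCount)
  cross-multiplied = NP.≤-trans (NP.*-monoˡ-≤ (n G) αH≤) (NP.≤-reflexive (begin
    L.layerCount * a * n G   ≡⟨ cong (_* n G) (NP.*-comm L.layerCount a) ⟩
    a * L.layerCount * n G   ≡⟨ NP.*-assoc a L.layerCount (n G) ⟩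
    a * (L.layerCount * n G) ≡⟨ cong (a *_) (NP.*-comm L.layerCount (n G)) ⟩
    a * (n G * L.layerCount) ∎))
    where open ≡-Reasoning
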